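{- For every animal $A$ with threshold sequence $\tau(A)=(b_1,b_2,\ldots)$ there is an index $k\in\mathbf{W}$ such that $b_n$ is finite for all $n<k$ and $b_n=\infty$ for all $n\ge k$.
   Context: A board is one of the regular tilings (square, triangular or hexagonal tiling of the plane, or the cubic tiling of space); its tiles are cells, adjacent if they share an edge (face for cubes). An animal is a finite connected set of cells up to congruence. In the weak $(a,b)$ achievement game ($a\ge1$, $b\ge0$) for goal animal $A$ on the infinite board, maker and breaker alternately mark previously unmarked cells, maker first, $a$ resp. $b$ cells per turn; the maker wins if his marked cells at some point contain a set congruent to $A$; $A$ is an $(a,b)$-winner if the maker has a strategy guaranteeing a win in finitely many turns against every breaker play. The threshold sequence of $A$ is $\tau(A)=(b_1,b_2,\ldots)$ where $b_n\in\mathbf{W}\cup\{\infty\}$ is the greatest value $b$ for which $A$ is an $(n,b)$-winner ($b_n=\infty$ if $A$ is an $(n,b)$-winner for every $b$); $\tau(A)(n)$ denotes $b_n$. -}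

module Defs where

open import Level using (0ℓ)
open import Data.Nat using (ℕ; zero; suc; _≤_; _<_)
open import Data.Integer as ℤ using (ℤ; +_; -_; ∣_∣)
open import Data.Bool using (Bool; true; false; if_then_else_)
open import Data.Fin using (Fin; toℕ)
open import Data.Fin.Permutation using (Permutation′; _⟨$⟩ʳ_)
open import Data.Vec using (Vec; lookup; tabulate; zipWith)
import Data.Vec as V
open import Data.List using (List; []; _∷_; _++_; length)
open import Data.List.Membership.Propositional using (_∈_; _∉_)
open import Data.List.Relation.Unary.All using (All)
open import Data.List.Relation.Unary.Any using (Any)
open import Data.List.Relation.Unary.Unique.Propositional using (Unique)
open import Data.Product using (_×_; _,_; ∃; Σ)
open import Data.Sum using (_⊎_)
open import Relation.Binary.PropositionalEquality using (_≡_; _≢_)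

data Board : Set where
  square triangular hexagonal cubic : Board

-- Cells.
--  * square / cubic : unit squares / unit cubes, named by their integer
--    coordinates (Vec ℤ 2 / Vec ℤ 3).
--  * hexagonal : hexagons, named by the axial coordinates (x , y) of their
--    centres w.r.t. the basis e₁ = (1,0), e₂ = (1/2, √3/2).
--  * triangular : triangles of the tiling whose vertices are the lattice
--    ℤe₁ + ℤe₂; (x , y , false) is the "up" triangle with vertices
--    (x,y),(x+1,y),(x,y+1); (x , y , true) is the "down" triangle with
--    vertices (x+1,y),(x,y+1),(x+1,y+1).
Cell : Board → Set
Cell square      = Vec ℤ 2
Cell cubic       = Vec ℤ 3
Cell hexagonal   = ℤ × ℤ
Cell triangular  = ℤ × ℤ × Bool

hexDirs : List (ℤ × ℤ)
hexDirs = (+ 1 , + 0) ∷ (- + 1 , + 0) ∷ (+ 0 , + 1) ∷ (+ 0 , - + 1)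
        ∷ (+ 1 , - + 1) ∷ (- + 1 , + 1) ∷ []

-- an up triangle and a down triangle sharing an edge
TriStep : Cell triangular → Cell triangular → Set
TriStep (x , y , false) (x' , y' , true) =
  (x' , y') ∈ ((x , y) ∷ (x ℤ.- + 1 , y) ∷ (x , y ℤ.- + 1) ∷ [])
TriStep _ _ = Data.Empty.⊥
  where import Data.Empty

taxi : ∀ {d} → Vec ℤ d → Vec ℤ d → ℕ
taxi u v = V.sum (V.map ∣_∣ (zipWith ℤ._-_ u v))

Adj : (B : Board) → Cell B → Cell B → Set
Adj square     u v = taxi u v ≡ 1
Adj cubic      u v = taxi u v ≡ 1
Adj hexagonal  (x , y) (x' , y') = (x ℤ.- x' , y ℤ.- y') ∈ hexDirs
Adj triangular c c' = TriStep c c' ⊎ TriStep c' c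

-- Hypercubic boards ℤᵈ: x ↦ (± x_{π(i)})ᵢ + t  (all d!·2ᵈ point symmetries
-- composed with all integer translations).
signed : Bool → ℤ → ℤ
signed s z = if s then - z else z

HSym : ℕ → Set
HSym d = Permutation′ d × Vec Bool d × Vec ℤ d

hAct : ∀ {d} → HSym d → Vec ℤ d → Vec ℤ d
hAct (π , s , t) x =
  tabulate (λ i → signed (lookup s i) (lookup x (π ⟨$⟩ʳ i)) ℤ.+ lookup t i)

-- Triangular lattice in axial coordinates: the dihedral group of order 12
-- is generated by the 60°-rotation rot and the reflection refl.
rot : ℤ × ℤ → ℤ × ℤ
rot (x , y) = (- y , x ℤ.+ y)

refl′ : ℤ × ℤ → ℤ × ℤ
refl′ (x , y) = (y , x)

iter : ℕ → (ℤ × ℤ → ℤ × ℤ) → ℤ × ℤ → ℤ × ℤ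
iter zero    f p = p
iter (suc n) f p = f (iter n f p)

point6 : Fin 6 → Bool → ℤ × ℤ → ℤ × ℤ
point6 k s p = iter (toℕ k) rot (if s then refl′ p else p)

-- Symmetries of the triangular lattice: point symmetry followed by a
-- lattice translation. These are exactly the symmetries of both the
-- hexagonal and the triangular tiling.
LSym : Set
LSym = Fin 6 × Bool × ℤ × ℤ

lAct : LSym → ℤ × ℤ → ℤ × ℤ
lAct (k , s , t₁ , t₂) p with point6 k s p
... | (x , y) = (x ℤ.+ t₁ , y ℤ.+ t₂)

-- Centroid of a triangle, in axial coordinates scaled by 3.
centroid : Cell triangular → ℤ × ℤ
centroid (x , y , false) = (+ 3 ℤ.* x ℤ.+ + 1 , + 3 ℤ.* y ℤ.+ + 1)
centroid (x , y , true)  = (+ 3 ℤ.* x ℤ.+ + 2 , + 3 ℤ.* y ℤ.+ + 2)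

lAct3 : LSym → ℤ × ℤ → ℤ × ℤ
lAct3 (k , s , t₁ , t₂) = lAct (k , s , + 3 ℤ.* t₁ , + 3 ℤ.* t₂)

Sym : Board → Set
Sym square     = HSym 2
Sym cubic      = HSym 3
Sym hexagonal  = LSym
Sym triangular = LSym

Maps : (B : Board) → Sym B → Cell B → Cell B → Set
Maps square     g c c' = c' ≡ hAct g c
Maps cubic      g c c' = c' ≡ hAct g c
Maps hexagonal  g c c' = c' ≡ lAct g c
Maps triangular g c c' = centroid c' ≡ lAct3 g (centroid c)

-- Animals: nonempty finite connected sets of cells (given by a list;
-- "up to congruence" is handled by allowing any representative).

data Path (B : Board) (A : List (Cell B)) : Cell B → Cell B → Set where
  stop : ∀ {c} → Path B A c c
  step : ∀ {c c' c''} → c' ∈ A → Adj B c c' → Path B A c' c'' → Path B A c c''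

IsAnimal : (B : Board) → List (Cell B) → Set
IsAnimal B A = (A ≢ []) × (∀ {c c'} → c ∈ A → c' ∈ A → Path B A c c')

module _ (B : Board) (A : List (Cell B)) where

  ContainsCopy : List (Cell B) → Set
  ContainsCopy M = ∃ λ (g : Sym B) → All (λ c → Any (Maps B g c) M) A

  LegalMove : ℕ → List (Cell B) → List (Cell B) → Set
  LegalMove k marked mv = (length mv ≡ k) × Unique mv × All (_∉ marked) mv

  -- MakerWins a b M Br : in the position where maker has marked M and
  -- breaker has marked Br, with maker to move, maker can force a win in
  -- finitely many turns (well-founded game tree).
  data MakerWins (a b : ℕ) (M Br : List (Cell B)) : Set where
    move : (mv : List (Cell B)) → LegalMove a (M ++ Br) mv →
           (ContainsCopy (mv ++ M) ⊎
            ((bm : List (Cell B)) → LegalMove b (mv ++ M ++ Br) bm →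
               MakerWins a b (mv ++ M) (bm ++ Br))) →
           MakerWins a b M Br

  Winner : ℕ → ℕ → Set
  Winner a b = MakerWins a b [] []

  ThresholdIs : ℕ → ℕ → Set
  ThresholdIs n b = Winner n b × (∀ b' → Winner n b' → b' ≤ b)

  ThresholdFinite : ℕ → Set
  ThresholdFinite n = ∃ λ b → ThresholdIs n b

  ThresholdInfinite : ℕ → Set
  ThresholdInfinite n = ∀ b → Winner n b

module Submission where

-- The heart of the proof is a monotonicity principle for the weak achievement
-- game (lemma `simulate`): a maker who wins the (a,b)-game from a position
-- also wins the (a',b')-game, for a ≤ a' and b' ≤ b, from any position in
-- which he owns more and the breaker owns less.  Every move of the new game is
-- translated into a move of the old one (lemma `translate`): drop the cells
-- that are already one's own, pad with fresh cells far away on the infinite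
-- board.  Two concrete strategies complete the picture: with no breaker the
-- maker wins the (1,0)-game by marking the cells of A one at a time, and with
-- |A| cells per turn he marks all of A at once against any breaker.
-- Hence "A is an (n,b)-winner for all b" is upward closed in n and holds for
-- n = |A|; it has a least witness k (classically), and below k the winning
-- values of b form a nonempty down-set of ℕ that is not all of ℕ, which
-- classically has a greatest element.

open import Defs
open import Level using (0ℓ)
open import Axiom.ExcludedMiddle using (ExcludedMiddle)
open import Data.Nat using (ℕ; _≤_; _<_)
open import Data.List using (List)
open import Data.Product using (_×_; ∃)

open import Axiom.DoubleNegationElimination using (em⇒dne)
open import Data.Bool as Bool using (false)
open import Data.Empty using (⊥-elim)
open import Data.Fin using () renaming (zero to fzero)
import Data.Fin.Permutation as Permutation
open import Data.Integer as ℤ using (+_)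
import Data.Integer.Properties as ℤ
open import Data.List using ([]; _∷_; _++_; length; filter; applyUpTo; deduplicate)
open import Data.List.Membership.Propositional using (_∈_; _∉_)
open import Data.List.Membership.Propositional.Properties
  using (∈-++⁺ˡ; ∈-++⁺ʳ; ∈-++⁻; ∈-filter⁺; ∈-filter⁻; ∈-applyUpTo⁻; ∈-deduplicate⁺)
open import Data.List.Membership.DecPropositional as DecMembership using ()
open import Data.List.Properties
  using (length-++; length-filter; length-applyUpTo; length-deduplicate; ++-assoc)
open import Data.List.Relation.Binary.Permutation.Propositional.Properties as Perm using ()
open import Data.List.Relation.Binary.Subset.Propositional using (_⊆_)
open import Data.List.Relation.Binary.Subset.Propositional.Properties
  using (⊆-refl; ⊆-trans; ⊆-reflexive-↭; Any-resp-⊆; xs⊆xs++ys; xs⊆ys++xs; ++⁺ˡ; ++⁺ʳ; module ⊆-Reasoning)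
open import Data.List.Relation.Unary.All as All using (All; []; _∷_)
open import Data.List.Relation.Unary.All.Properties as All using ()
import Data.List.Relation.Unary.Any as Any
open import Data.List.Relation.Unary.Any using (here; there)
open import Data.List.Relation.Unary.AllPairs using ([]; _∷_)
open import Data.List.Relation.Unary.Unique.Propositional using (Unique)
open import Data.List.Relation.Unary.Unique.Propositional.Properties as Unique using ()
import Data.List.Relation.Unary.Unique.DecPropositional.Properties as UniqueDec
open import Data.Nat using (zero; suc; _+_; _∸_; _⊔_; z≤n)
open import Data.Nat.Properties
  using (≤-refl; ≤-trans; ≤-pred; ≮⇒≥; <⇒≢; <-irrefl; +-cancelˡ-≡; m≤m+n; m≤m⊔n; m≤n⊔m; m+[n∸m]≡n)
open import Data.Product using (_,_; proj₁; proj₂)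
import Data.Product.Properties as Product
open import Data.Sum using (inj₁; inj₂)
open import Data.Vec using ([]; _∷_)
import Data.Vec.Properties as Vec
open import Relation.Binary.Definitions using (DecidableEquality)
open import Relation.Binary.PropositionalEquality
  using (_≡_; refl; sym; trans; cong; cong₂; subst; module ≡-Reasoning)
open import Relation.Nullary using (¬_; yes; no)

-- Moves on an arbitrary infinite set of cells C with decidable equality.
-- Infinity is witnessed by cells `label i` that `index` tells apart.
module Moves {C : Set} (_≟_ : DecidableEquality C)
             (label : ℕ → C) (index : C → ℕ)
             (index-label : ∀ i → index (label i) ≡ i) where

  open DecMembership _≟_ using (_∈?_; _∉?_)

  IsMove : ℕ → List C → List C → Set
  IsMove k marked ys = length ys ≡ k × Unique ys × All (_∉ marked) ys

  bound : List C → ℕ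
  bound []       = 0
  bound (c ∷ cs) = index c ⊔ bound cs

  index≤bound : ∀ {c cs} → c ∈ cs → index c ≤ bound cs
  index≤bound {cs = c ∷ _}  (here refl) = m≤m⊔n (index c) _
  index≤bound {cs = d ∷ cs} (there c∈cs) = ≤-trans (index≤bound c∈cs) (m≤n⊔m (index d) (bound cs))

  fresh : List C → ℕ → List C
  fresh L = applyUpTo (λ i → label (suc (bound L) + i))

  fresh-length : ∀ L k → length (fresh L k) ≡ k
  fresh-length L = length-applyUpTo _

  fresh-unique : ∀ L k → Unique (fresh L k)
  fresh-unique L k = Unique.applyUpTo⁺₁ _ k λ i<j _ same →
    <⇒≢ i<j (+-cancelˡ-≡ (suc (bound L)) _ _
      (trans (sym (index-label _)) (trans (cong index same) (index-label _))))

  fresh-avoids : ∀ L k → All (_∉ L) (fresh L k)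
  fresh-avoids L k = All.tabulate λ v∈fresh v∈L → avoid (∈-applyUpTo⁻ _ v∈fresh) v∈L
    where
    avoid : ∀ {v} → ∃ (λ i → i < k × v ≡ label (suc (bound L) + i)) → v ∉ L
    avoid (i , _ , refl) v∈L = <-irrefl refl (≤-trans (m≤m+n (suc (bound L)) i)
      (subst (_≤ bound L) (index-label _) (index≤bound v∈L)))

  fresh-move : ∀ k marked → IsMove k marked (fresh marked k)
  fresh-move k marked = fresh-length marked k , fresh-unique marked k , fresh-avoids marked k

  translate : ∀ {k₁ k₂ own own' F₁ F₂ mv} → k₁ ≤ k₂ → own ⊆ own' → F₂ ⊆ own' ++ F₁ →
              IsMove k₁ F₁ mv → ∃ λ mv' → IsMove k₂ F₂ mv' × mv ++ own ⊆ mv' ++ own'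
  translate {k₁} {k₂} {own} {own'} {F₁} {F₂} {mv} k₁≤k₂ own⊆own' F₂⊆ (refl , mv! , mv-avoids) =
    kept ++ pad , (size , distinct , avoids) , covers
    where
    kept pad : List C
    kept = filter (_∉? own') mv
    pad  = fresh (F₂ ++ mv) (k₂ ∸ length kept)

    size : length (kept ++ pad) ≡ k₂
    size = begin
      length (kept ++ pad)               ≡⟨ length-++ kept ⟩
      length kept + length pad           ≡⟨ cong (λ n → length kept + n) (fresh-length (F₂ ++ mv) _) ⟩
      length kept + (k₂ ∸ length kept)   ≡⟨ m+[n∸m]≡n (≤-trans (length-filter _ mv) k₁≤k₂) ⟩
      k₂                                 ∎
      where open ≡-Reasoning

    distinct : Unique (kept ++ pad)
    distinct = Unique.++⁺ (Unique.filter⁺ _ mv!) (fresh-unique (F₂ ++ mv) _)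
      λ (v∈kept , v∈pad) → All.lookup (fresh-avoids (F₂ ++ mv) _) v∈pad
                             (∈-++⁺ʳ F₂ (proj₁ (∈-filter⁻ _ v∈kept)))

    -- a kept cell is neither owned nor in F₁, hence not in F₂
    kept-avoids : ∀ {v} → v ∈ kept → v ∉ F₂
    kept-avoids v∈kept v∈F₂ with ∈-filter⁻ (_∉? own') v∈kept | ∈-++⁻ own' (F₂⊆ v∈F₂)
    ... | _    , v∉own' | inj₁ v∈own' = v∉own' v∈own'
    ... | v∈mv , _      | inj₂ v∈F₁   = All.lookup mv-avoids v∈mv v∈F₁

    avoids : All (_∉ F₂) (kept ++ pad)
    avoids = All.++⁺ (All.tabulate kept-avoids)
                     (All.map (λ v∉F₂++mv v∈F₂ → v∉F₂++mv (∈-++⁺ˡ v∈F₂)) (fresh-avoids (F₂ ++ mv) _))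

    covers : mv ++ own ⊆ (kept ++ pad) ++ own'
    covers {x} x∈ with ∈-++⁻ mv x∈
    ... | inj₂ x∈own = ∈-++⁺ʳ (kept ++ pad) (own⊆own' x∈own)
    ... | inj₁ x∈mv with x ∈? own'
    ...   | yes x∈own' = ∈-++⁺ʳ (kept ++ pad) x∈own'
    ...   | no  x∉own' = ∈-++⁺ˡ (∈-++⁺ˡ (∈-filter⁺ (_∉? own') x∈mv x∉own'))

cell-≟ : (B : Board) → DecidableEquality (Cell B)
cell-≟ square     = Vec.≡-dec ℤ._≟_
cell-≟ cubic      = Vec.≡-dec ℤ._≟_
cell-≟ hexagonal  = Product.≡-dec ℤ._≟_ ℤ._≟_
cell-≟ triangular = Product.≡-dec ℤ._≟_ (Product.≡-dec ℤ._≟_ Bool._≟_)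

label : (B : Board) → ℕ → Cell B
label square     i = + i ∷ + 0 ∷ []
label cubic      i = + i ∷ + 0 ∷ + 0 ∷ []
label hexagonal  i = + i , + 0
label triangular i = + i , + 0 , false

index : (B : Board) → Cell B → ℕ
index square     (x ∷ _) = ℤ.∣ x ∣
index cubic      (x ∷ _) = ℤ.∣ x ∣
index hexagonal  (x , _) = ℤ.∣ x ∣
index triangular (x , _) = ℤ.∣ x ∣

index-label : ∀ B i → index B (label B i) ≡ i
index-label square     i = refl
index-label cubic      i = refl
index-label hexagonal  i = refl
index-label triangular i = refl

identity : (B : Board) → Sym B
identity square     = Permutation.id , false ∷ false ∷ [] , + 0 ∷ + 0 ∷ []
identity cubic      = Permutation.id , false ∷ false ∷ false ∷ [] , + 0 ∷ + 0 ∷ + 0 ∷ []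
identity hexagonal  = fzero , false , + 0 , + 0
identity triangular = fzero , false , + 0 , + 0

identity-maps : ∀ B c → Maps B (identity B) c c
identity-maps square (x ∷ y ∷ []) =
  sym (cong₂ (λ a b → a ∷ b ∷ []) (ℤ.+-identityʳ x) (ℤ.+-identityʳ y))
identity-maps cubic (x ∷ y ∷ z ∷ []) =
  sym (cong₂ _∷_ (ℤ.+-identityʳ x) (cong₂ (λ a b → a ∷ b ∷ []) (ℤ.+-identityʳ y) (ℤ.+-identityʳ z)))
identity-maps hexagonal (x , y) = sym (cong₂ _,_ (ℤ.+-identityʳ x) (ℤ.+-identityʳ y))
identity-maps triangular c =
  sym (cong₂ _,_ (ℤ.+-identityʳ (proj₁ (centroid c))) (ℤ.+-identityʳ (proj₂ (centroid c))))

module Game (B : Board) (A : List (Cell B)) where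

  open Moves (cell-≟ B) (label B) (index B) (index-label B)

  copy-mono : ∀ {M M'} → M ⊆ M' → ContainsCopy B A M → ContainsCopy B A M'
  copy-mono M⊆M' (g , placed) = g , All.map (Any-resp-⊆ M⊆M') placed

  copy-of-superset : ∀ {X} → A ⊆ X → ContainsCopy B A X
  copy-of-superset A⊆X =
    identity B , All.tabulate λ {c} c∈A → Any.map (λ { refl → identity-maps B c }) (A⊆X c∈A)

  -- Forbidden cells of a translated maker move: the breaker owns less.
  maker-forbidden : ∀ {M M' Br Br' : List (Cell B)} → Br' ⊆ Br → M' ++ Br' ⊆ M' ++ (M ++ Br)
  maker-forbidden {M} {M'} {Br} Br'⊆Br = ++⁺ʳ M' (⊆-trans Br'⊆Br (xs⊆ys++xs Br M))

  -- Forbidden cells of a translated breaker move: the maker owns more.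
  breaker-forbidden : ∀ {mv M mv' M' Br Br' : List (Cell B)} → mv ++ M ⊆ mv' ++ M' →
                      mv ++ M ++ Br ⊆ Br ++ (mv' ++ M' ++ Br')
  breaker-forbidden {mv} {M} {mv'} {M'} {Br} {Br'} cover = begin
    mv ++ M ++ Br                ≡⟨ sym (++-assoc mv M Br) ⟩
    (mv ++ M) ++ Br              ⊆⟨ ++⁺ˡ Br cover ⟩
    (mv' ++ M') ++ Br            ⊆⟨ ⊆-reflexive-↭ (Perm.++-comm (mv' ++ M') Br) ⟩
    Br ++ (mv' ++ M')            ⊆⟨ ++⁺ʳ Br (xs⊆xs++ys (mv' ++ M') Br') ⟩
    Br ++ ((mv' ++ M') ++ Br')   ≡⟨ cong (Br ++_) (++-assoc mv' M' Br') ⟩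
    Br ++ (mv' ++ M' ++ Br')     ∎
    where open ⊆-Reasoning (Cell B)

  -- Maker moves are translated forward, breaker moves back.
  simulate : ∀ {a b a' b' M Br M' Br'} → a ≤ a' → b' ≤ b → M ⊆ M' → Br' ⊆ Br →
             MakerWins B A a b M Br → MakerWins B A a' b' M' Br'
  simulate {M = M} {Br} {M'} {Br'} a≤a' b'≤b M⊆M' Br'⊆Br (move mv legal outcome)
    with translate a≤a' M⊆M' (maker-forbidden {M} {M'} {Br} {Br'} Br'⊆Br) legal
  ... | mv' , legal' , cover with outcome
  ...   | inj₁ copy     = move mv' legal' (inj₁ (copy-mono cover copy))
  ...   | inj₂ continue = move mv' legal' (inj₂ λ bm' b-legal' →
          let (bm , b-legal , b-cover) = translate b'≤b Br'⊆Br (breaker-forbidden {mv} {M} {mv'} {M'} {Br} {Br'} cover) b-legal'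
          in simulate a≤a' b'≤b cover b-cover (continue bm b-legal))

  -- Without a breaker the maker collects the remaining cells R of A one per
  -- turn, from any position M with A ⊆ R ++ M.
  one-by-one : ∀ R M → A ⊆ R ++ M → MakerWins B A 1 0 M []
  one-by-one [] M A⊆M =
    move (fresh (M ++ []) 1) (fresh-move 1 (M ++ []))
      (inj₁ (copy-of-superset (⊆-trans A⊆M (xs⊆ys++xs M _))))
  one-by-one (c ∷ R) M A⊆c∷R++M
    with translate {own = M} {F₁ = []} {mv = c ∷ []} ≤-refl ⊆-refl ⊆-refl
           (refl , ([] ∷ []) , ((λ ()) ∷ []))
  ... | mv , legal , c∷M⊆ = move mv legal (inj₂ λ
          { [] _ → one-by-one R (mv ++ M) (⊆-trans A⊆c∷R++M still-covered)
          ; (_ ∷ _) (() , _) })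
    where
    still-covered : (c ∷ R) ++ M ⊆ R ++ (mv ++ M)
    still-covered (here refl) = ∈-++⁺ʳ R (c∷M⊆ (here refl))
    still-covered (there x∈R++M) with ∈-++⁻ R x∈R++M
    ... | inj₁ x∈R = ∈-++⁺ˡ x∈R
    ... | inj₂ x∈M = ∈-++⁺ʳ R (c∷M⊆ (there x∈M))

  wins-alone : ∀ {n} → 1 ≤ n → Winner B A n 0
  wins-alone 1≤n = simulate 1≤n z≤n ⊆-refl ⊆-refl (one-by-one A [] (xs⊆xs++ys A []))

  -- τ(A)(|A|) = ∞: marking all of A (padded to |A| cells) wins at once.
  wins-at-once : ThresholdInfinite B A (length A)
  wins-at-once b with translate {own = []} {F₁ = []} {F₂ = []} {mv = deduplicate (cell-≟ B) A}
                     (length-deduplicate (cell-≟ B) A) ⊆-refl (λ ())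
                     (refl , UniqueDec.deduplicate-! (cell-≟ B) A , All.tabulate (λ _ ()))
  ... | mv , legal , cover =
    move mv legal (inj₁ (copy-of-superset λ c∈A → cover (∈-++⁺ˡ (∈-deduplicate⁺ (cell-≟ B) c∈A))))

module Classical (em : ExcludedMiddle 0ℓ) (P : ℕ → Set) where

  least-witness : (∀ {m n} → m ≤ n → P m → P n) → ∀ m → P m →
                  ∃ λ k → (∀ n → n < k → ¬ P n) × (∀ n → k ≤ n → P n)
  least-witness up zero P0 = 0 , (λ _ ()) , λ _ 0≤n → up 0≤n P0
  least-witness up (suc m) P1+m with em {P m}
  ... | yes Pm = least-witness up m Pm
  ... | no ¬Pm = suc m , (λ n n<1+m Pn → ¬Pm (up (≤-pred n<1+m) Pn)) , λ _ 1+m≤n → up 1+m≤n P1+m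

  greatest-below : (∀ {m n} → m ≤ n → P n → P m) → P 0 → ∀ m → ¬ P m →
                   ∃ λ b → P b × ∀ b' → P b' → b' ≤ b
  greatest-below down P0 zero    ¬P0 = ⊥-elim (¬P0 P0)
  greatest-below down P0 (suc m) ¬P1+m with em {P m}
  ... | no ¬Pm = greatest-below down P0 m ¬Pm
  ... | yes Pm = m , Pm , λ b' Pb' → ≮⇒≥ λ m<b' → ¬P1+m (down m<b' Pb')

  greatest : (∀ {m n} → m ≤ n → P n → P m) → P 0 → ¬ (∀ n → P n) →
             ∃ λ b → P b × ∀ b' → P b' → b' ≤ b
  greatest down P0 ¬all =
    let (m , ¬Pm) = counterexample in greatest-below down P0 m ¬Pm
    where
    counterexample : ∃ λ m → ¬ P m
    counterexample = em⇒dne em λ none → ¬all λ n → em⇒dne em λ ¬Pn → none (n , ¬Pn)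

proposition5p3 : ExcludedMiddle 0ℓ →
    (B : Board) (A : List (Cell B)) → IsAnimal B A →
    ∃ λ (k : ℕ) →
      (∀ n → 1 ≤ n → n < k → ThresholdFinite B A n) ×
      (∀ n → 1 ≤ n → k ≤ n → ThresholdInfinite B A n)
proposition5p3 em B A _ =
  let (k , finite-below , infinite-above) =
        least-witness (ThresholdInfinite B A) more-cells (length A) wins-at-once
  in k , (λ n 1≤n n<k → greatest (Winner B A n) fewer-breaker-cells
                                  (wins-alone 1≤n) (finite-below n n<k))
       , (λ n _ k≤n → infinite-above n k≤n)
  where
  open Game B A
  open Classical em

  more-cells : ∀ {m n} → m ≤ n → ThresholdInfinite B A m → ThresholdInfinite B A n
  more-cells m≤n wins b = simulate m≤n ≤-refl ⊆-refl ⊆-refl (wins b)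

  fewer-breaker-cells : ∀ {n b' b} → b' ≤ b → Winner B A n b → Winner B A n b'
  fewer-breaker-cells b'≤b = simulate ≤-refl b'≤b ⊆-refl ⊆-refl
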